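{- Let $\mathcal{A}$ be a commutative algebra over a field $F$, let $R_n,q_n\in\mathcal A$ for $n\geq0$ with $q_0=1$, set $q_n=0$ for $n<0$, and for integers $i,j$ put $q_{(i,j)}=q_iq_j$. Assume that for each $n\geq1$ there is $c_n\in F$ with $\sum_{i\geq1}R_iq_{n-i}=c_nq_n$, and set $c_0=0$. Then for all integers $m\geq n\geq 1$, $$\sum_{i,j\geq 1}R_{i+j}\,q_{m-i}\,q_{n-j}=\sum_{(i,j)}(c_i-c_j)\,q_{(i,j)}-c_n\,q_{(m,n)},$$ where the sum on the right runs over all pairs of integers $(i,j)$ with $i\geq j\geq 0$, $i+j=m+n$ and $i>m$. -}

module Defs where

open import Level using (Level; _⊔_) renaming (suc to lsuc)
open import Algebra.Bundles using (CommutativeRing)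
open import Algebra.Morphism.Structures using (module RingMorphisms)
open import Data.Nat using (ℕ; zero; suc; _∸_; _<?_; _≤?_)
open import Data.Product using (∃)
open import Data.Bool using (if_then_else_; _∧_)
open import Relation.Nullary using (¬_)
open import Relation.Nullary.Decidable using (⌊_⌋)

record Field (c ℓ : Level) : Set (lsuc (c ⊔ ℓ)) where
  field
    commutativeRing : CommutativeRing c ℓ
  open CommutativeRing commutativeRing public
  field
    1≉0     : ¬ (1# ≈ 0#)
    inverse : ∀ x → ¬ (x ≈ 0#) → ∃ λ y → x * y ≈ 1#

record CommAlgebra {f ℓf : Level} (F : Field f ℓf) (a ℓa : Level)
       : Set (f ⊔ ℓf ⊔ lsuc (a ⊔ ℓa)) where
  field
    commRing : CommutativeRing a ℓa
  open CommutativeRing commRing public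
  field
    ι     : Field.Carrier F → Carrier
    ι-hom : RingMorphisms.IsRingHomomorphism
              (CommutativeRing.rawRing (Field.commutativeRing F))
              (CommutativeRing.rawRing commRing) ι

  infixr 7 _·_
  _·_ : Field.Carrier F → Carrier → Carrier
  c · x = ι c * x

  sumBelow : ℕ → (ℕ → Carrier) → Carrier
  sumBelow zero    g = 0#
  sumBelow (suc n) g = sumBelow n g + g n

  Scalar : Set f
  Scalar = Field.Carrier F

  infix 4 _≈ˢ_
  _≈ˢ_ : Scalar → Scalar → Set ℓf
  _≈ˢ_ = Field._≈_ F

  0ˢ : Scalar
  0ˢ = Field.0# F

  infixl 6 _-ˢ_
  _-ˢ_ : Scalar → Scalar → Scalar
  _-ˢ_ = Field._-_ F

module Submission where

-- Write q̂ k = c k · q k.  The hypothesis says that q̂ (m+1) = R₁ q m + X m,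
-- where X m = Σ_{k<m} R_{k+2} q_{m-1-k} is the "tail" of the convolution.
-- Splitting off the j = 1 (resp. i = 1) slice of the double sum
--   T m n = Σ_{1≤i≤m} Σ_{1≤j≤n} R_{i+j} q_{m-i} q_{n-j}
-- shows that T m (n+1) and T (m+1) n differ only by these slices, which
-- the hypothesis turns into the recurrence
--   T m (n+1) + q m · q̂ (n+1) = q̂ (m+1) · q n + T (m+1) n.
-- Iterating it along the antidiagonal {(i,j) | i + j = m + n - 1} expresses
-- T m n as a difference of two antidiagonal sums of the products q̂ · q and
-- q · q̂; using q̂ 0 = 0 to realign the second one, and recognising the
-- pair sum of the theorem as the antidiagonal sum of
-- (c i - c j) q_i q_j = q̂ i q j - q i q̂ j, gives the identity.

open import Defs
open import Level using (Level)
open import Data.Nat using (ℕ; zero; suc; _∸_; _≤_; _<_; _<?_; _≤?_; s≤s; z≤n)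
import Data.Nat as N
import Data.Nat.Properties as NP
open import Data.Bool using (if_then_else_; _∧_)
open import Relation.Nullary using (yes; no; contradiction)
open import Relation.Nullary.Decidable using (⌊_⌋)
open import Relation.Binary.PropositionalEquality as P using (_≡_)
open import Algebra.Morphism.Structures using (module RingMorphisms)
import Algebra.Solver.Ring.NaturalCoefficients.Default as SemiringSolver
import Algebra.Properties.Group as GroupProperties
import Algebra.Properties.AbelianGroup as AbelianGroupProperties
import Algebra.Properties.Ring as RingProperties
import Relation.Binary.Reasoning.Setoid as SetoidReasoning

module FiniteSums {f ℓf a ℓa : Level} {F : Field f ℓf} (𝒜 : CommAlgebra F a ℓa) where
  open CommAlgebra 𝒜
  open SetoidReasoning setoid
  open SemiringSolver commutativeSemiring

  sumBelow-cong : ∀ n {g h : ℕ → Carrier} →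
    (∀ k → k < n → g k ≈ h k) → sumBelow n g ≈ sumBelow n h
  sumBelow-cong zero    g≈h = refl
  sumBelow-cong (suc n) g≈h =
    +-cong (sumBelow-cong n (λ k k<n → g≈h k (NP.m<n⇒m<1+n k<n))) (g≈h n NP.≤-refl)

  sumBelow-vanishing : ∀ n {g : ℕ → Carrier} → (∀ k → k < n → g k ≈ 0#) → sumBelow n g ≈ 0#
  sumBelow-vanishing zero    g≈0 = refl
  sumBelow-vanishing (suc n) g≈0 = begin
    sumBelow n _ + _ ≈⟨ +-cong (sumBelow-vanishing n (λ k k<n → g≈0 k (NP.m<n⇒m<1+n k<n)))
                               (g≈0 n NP.≤-refl) ⟩
    0# + 0#          ≈⟨ +-identityʳ 0# ⟩
    0#               ∎

  sumBelow-head : ∀ n (g : ℕ → Carrier) →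
    sumBelow (suc n) g ≈ g 0 + sumBelow n (λ k → g (suc k))
  sumBelow-head zero    g = trans (+-identityˡ _) (sym (+-identityʳ _))
  sumBelow-head (suc n) g = begin
    sumBelow (suc n) g + g (suc n)                      ≈⟨ +-congʳ (sumBelow-head n g) ⟩
    (g 0 + sumBelow n (λ k → g (suc k))) + g (suc n)    ≈⟨ +-assoc _ _ _ ⟩
    g 0 + sumBelow (suc n) (λ k → g (suc k))            ∎

  sumBelow-split : ∀ a b (g : ℕ → Carrier) →
    sumBelow (a N.+ b) g ≈ sumBelow a g + sumBelow b (λ t → g (a N.+ t))
  sumBelow-split a zero    g rewrite NP.+-identityʳ a = sym (+-identityʳ _)
  sumBelow-split a (suc b) g rewrite NP.+-suc a b = begin
    sumBelow (a N.+ b) g + g (a N.+ b)                                ≈⟨ +-congʳ (sumBelow-split a b g) ⟩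
    (sumBelow a g + sumBelow b (λ t → g (a N.+ t))) + g (a N.+ b)     ≈⟨ +-assoc _ _ _ ⟩
    sumBelow a g + sumBelow (suc b) (λ t → g (a N.+ t))               ∎

  sumBelow-+ : ∀ n (g h : ℕ → Carrier) →
    sumBelow n (λ k → g k + h k) ≈ sumBelow n g + sumBelow n h
  sumBelow-+ zero    g h = sym (+-identityʳ 0#)
  sumBelow-+ (suc n) g h = begin
    sumBelow n (λ k → g k + h k) + (g n + h n)    ≈⟨ +-congʳ (sumBelow-+ n g h) ⟩
    (sumBelow n g + sumBelow n h) + (g n + h n)
      ≈⟨ solve 4 (λ G H x y → (G :+ H) :+ (x :+ y) := (G :+ x) :+ (H :+ y)) refl _ _ _ _ ⟩
    (sumBelow n g + g n) + (sumBelow n h + h n)   ∎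

  sumBelow-*ˡ : ∀ n (g : ℕ → Carrier) x → sumBelow n (λ k → x * g k) ≈ x * sumBelow n g
  sumBelow-*ˡ zero    g x = sym (zeroʳ x)
  sumBelow-*ˡ (suc n) g x = trans (+-congʳ (sumBelow-*ˡ n g x)) (sym (distribˡ x _ _))

  sumBelow-*ʳ : ∀ n (g : ℕ → Carrier) x → sumBelow n (λ k → g k * x) ≈ sumBelow n g * x
  sumBelow-*ʳ zero    g x = sym (zeroˡ x)
  sumBelow-*ʳ (suc n) g x = trans (+-congʳ (sumBelow-*ʳ n g x)) (sym (distribʳ x _ _))

-- Sums along an antidiagonal.  antidiagonal a m n = Σ_{t<n} a (m+t) (n-1-t)
-- is the sum of a over the lattice points (i , j) with i ≥ m, j ≥ 0 and
-- i + j + 1 = m + n, listed by increasing i.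
module AntiDiagonal {f ℓf a ℓa : Level} {F : Field f ℓf} (𝒜 : CommAlgebra F a ℓa) where
  open CommAlgebra 𝒜
  open SetoidReasoning setoid
  open SemiringSolver commutativeSemiring
  open FiniteSums 𝒜
  open AbelianGroupProperties +-abelianGroup using (⁻¹-∙-comm)

  antidiagonal : (ℕ → ℕ → Carrier) → ℕ → ℕ → Carrier
  antidiagonal a m zero    = 0#
  antidiagonal a m (suc n) = a m n + antidiagonal a (suc m) n

  antidiagonal-cong : ∀ {a b : ℕ → ℕ → Carrier} m n →
    (∀ i j → m ≤ i → j < n → i N.+ suc j ≡ m N.+ n → a i j ≈ b i j) →
    antidiagonal a m n ≈ antidiagonal b m n
  antidiagonal-cong m zero    a≈b = refl
  antidiagonal-cong m (suc n) a≈b =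
    +-cong (a≈b m n NP.≤-refl NP.≤-refl P.refl)
           (antidiagonal-cong (suc m) n λ i j m<i j<n i+j≡ →
              a≈b i j (NP.<⇒≤ m<i) (NP.m<n⇒m<1+n j<n) (P.trans i+j≡ (P.sym (NP.+-suc m n))))

  antidiagonal-sumBelow : ∀ (h : ℕ → Carrier) m n →
    antidiagonal (λ i _ → h i) m n ≈ sumBelow n (λ t → h (m N.+ t))
  antidiagonal-sumBelow h m zero    = refl
  antidiagonal-sumBelow h m (suc n) = begin
    h m + antidiagonal (λ i _ → h i) (suc m) n
      ≈⟨ +-cong (reflexive (P.cong h (P.sym (NP.+-identityʳ m))))
                (trans (antidiagonal-sumBelow h (suc m) n)
                       (sumBelow-cong n λ t _ → reflexive (P.cong h (P.sym (NP.+-suc m t))))) ⟩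
    h (m N.+ 0) + sumBelow n (λ t → h (m N.+ suc t))   ≈⟨ sym (sumBelow-head n _) ⟩
    sumBelow (suc n) (λ t → h (m N.+ t))               ∎

  antidiagonal-- : ∀ (a b : ℕ → ℕ → Carrier) m n →
    antidiagonal (λ i j → a i j - b i j) m n ≈ antidiagonal a m n - antidiagonal b m n
  antidiagonal-- a b m zero    = sym (-‿inverseʳ 0#)
  antidiagonal-- a b m (suc n) = begin
    (a m n - b m n) + antidiagonal (λ i j → a i j - b i j) (suc m) n
      ≈⟨ +-congˡ (antidiagonal-- a b (suc m) n) ⟩
    (a m n - b m n) + (antidiagonal a (suc m) n - antidiagonal b (suc m) n)
      ≈⟨ solve 4 (λ x y X Y → (x :+ y) :+ (X :+ Y) := (x :+ X) :+ (y :+ Y)) refl _ _ _ _ ⟩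
    (a m n + antidiagonal a (suc m) n) + (- b m n - antidiagonal b (suc m) n)
      ≈⟨ +-congˡ (⁻¹-∙-comm _ _) ⟩
    (a m n + antidiagonal a (suc m) n) - (b m n + antidiagonal b (suc m) n) ∎

  antidiagonal-shift : ∀ (a : ℕ → ℕ → Carrier) → (∀ i → a i 0 ≈ 0#) → ∀ m n →
    antidiagonal (λ i j → a i (suc j)) m n ≈ a m n + antidiagonal (λ i j → a (suc i) j) m n
  antidiagonal-shift a a₀≈0 m zero    = sym (trans (+-identityʳ _) (a₀≈0 m))
  antidiagonal-shift a a₀≈0 m (suc n) = +-congˡ (antidiagonal-shift a a₀≈0 (suc m) n)

  antidiagonal-telescope : ∀ (D a b : ℕ → ℕ → Carrier) →
    (∀ m → D m 0 ≈ 0#) →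
    (∀ m n → D m (suc n) + b m n ≈ a m n + D (suc m) n) →
    ∀ m n → D m n + antidiagonal b m n ≈ antidiagonal a m n
  antidiagonal-telescope D a b D₀≈0 step m zero    = trans (+-identityʳ _) (D₀≈0 m)
  antidiagonal-telescope D a b D₀≈0 step m (suc n) = begin
    D m (suc n) + (b m n + antidiagonal b (suc m) n)  ≈⟨ sym (+-assoc _ _ _) ⟩
    (D m (suc n) + b m n) + antidiagonal b (suc m) n  ≈⟨ +-congʳ (step m n) ⟩
    (a m n + D (suc m) n) + antidiagonal b (suc m) n  ≈⟨ +-assoc _ _ _ ⟩
    a m n + (D (suc m) n + antidiagonal b (suc m) n)
      ≈⟨ +-congˡ (antidiagonal-telescope D a b D₀≈0 step (suc m) n) ⟩
    a m n + antidiagonal a (suc m) n                  ∎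

module Identity {f ℓf a ℓa : Level} {F : Field f ℓf} (𝒜 : CommAlgebra F a ℓa)
                (R q : ℕ → CommAlgebra.Carrier 𝒜) (c : ℕ → CommAlgebra.Scalar 𝒜) where
  open CommAlgebra 𝒜
  open SetoidReasoning setoid
  open SemiringSolver commutativeSemiring
  open FiniteSums 𝒜
  open AntiDiagonal 𝒜
  open RingProperties ring using (-‿distribˡ-*)
  open AbelianGroupProperties +-abelianGroup using (⁻¹-∙-comm)
  open GroupProperties +-group using (//-rightDividesʳ)
  open RingMorphisms (Field.rawRing F) rawRing using (IsRingHomomorphism)
  private
    module ι = IsRingHomomorphism ι-hom

  q̂ : ℕ → Carrier
  q̂ k = c k · q k

  ConvolutionHypothesis : Set ℓa
  ConvolutionHypothesis =
    ∀ n → 1 ≤ n → sumBelow n (λ k → R (suc k) * q (n ∸ suc k)) ≈ c n · q n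

  doubleSum : ℕ → ℕ → Carrier
  doubleSum m n = sumBelow m (λ i′ → sumBelow n (λ j′ →
    R (suc i′ N.+ suc j′) * q (m ∸ suc i′) * q (n ∸ suc j′)))

  doubleSum-empty : ∀ m → doubleSum m 0 ≈ 0#
  doubleSum-empty m = sumBelow-vanishing m (λ _ _ → refl)

  tailConvolution : ℕ → Carrier
  tailConvolution m = sumBelow m (λ k → R (suc (suc k)) * q (m ∸ suc k))

  -- Splitting off the slice j = 1 of T m (n+1), resp. i = 1 of T (m+1) n,
  -- leaves the same sum over i, j ≥ 1 with R_{i+j+1}; hence
  --   T m (n+1) + q m X n = X m q n + T (m+1) n.
  doubleSum-exchange : ∀ m n →
    doubleSum m (suc n) + q m * tailConvolution n ≈ tailConvolution m * q n + doubleSum (suc m) n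
  doubleSum-exchange m n = begin
    doubleSum m (suc n) + q m * tailConvolution n       ≈⟨ +-congʳ lastColumn ⟩
    (tailConvolution m * q n + core) + q m * tailConvolution n
      ≈⟨ solve 3 (λ A B C → (A :+ B) :+ C := A :+ (C :+ B)) refl _ _ _ ⟩
    tailConvolution m * q n + (q m * tailConvolution n + core)  ≈⟨ +-congˡ (sym lastRow) ⟩
    tailConvolution m * q n + doubleSum (suc m) n       ∎
    where
    core : Carrier
    core = sumBelow m (λ i′ → sumBelow n (λ j″ →
      R (suc i′ N.+ suc (suc j″)) * q (m ∸ suc i′) * q (n ∸ suc j″)))

    lastColumn : doubleSum m (suc n) ≈ tailConvolution m * q n + core
    lastColumn = begin
      doubleSum m (suc n)
        ≈⟨ sumBelow-cong m (λ i′ _ → sumBelow-head n _) ⟩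
      sumBelow m (λ i′ → R (suc i′ N.+ 1) * q (m ∸ suc i′) * q n + sumBelow n (λ j″ →
        R (suc i′ N.+ suc (suc j″)) * q (m ∸ suc i′) * q (n ∸ suc j″)))
        ≈⟨ sumBelow-+ m _ _ ⟩
      sumBelow m (λ i′ → R (suc i′ N.+ 1) * q (m ∸ suc i′) * q n) + core
        ≈⟨ +-congʳ (sumBelow-cong m λ i′ _ →
             *-congʳ (*-congʳ (reflexive (P.cong R (NP.+-comm (suc i′) 1))))) ⟩
      sumBelow m (λ i′ → R (suc (suc i′)) * q (m ∸ suc i′) * q n) + core
        ≈⟨ +-congʳ (sumBelow-*ʳ m _ _) ⟩
      tailConvolution m * q n + core  ∎

    lastRow : doubleSum (suc m) n ≈ q m * tailConvolution n + core
    lastRow = begin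
      doubleSum (suc m) n
        ≈⟨ sumBelow-head m _ ⟩
      sumBelow n (λ j′ → R (suc (suc j′)) * q m * q (n ∸ suc j′)) + sumBelow m (λ i″ → sumBelow n (λ j′ →
        R (suc (suc i″) N.+ suc j′) * q (m ∸ suc i″) * q (n ∸ suc j′)))
        ≈⟨ +-cong (sumBelow-cong n λ j′ _ →
                     solve 3 (λ r x y → r :* x :* y := x :* (r :* y)) refl _ _ _)
                  (sumBelow-cong m λ i″ _ → sumBelow-cong n λ j′ _ →
                     *-congʳ (*-congʳ (reflexive (P.cong (λ k → R (suc k))
                                                         (P.sym (NP.+-suc i″ (suc j′))))))) ⟩
      sumBelow n (λ j′ → q m * (R (suc (suc j′)) * q (n ∸ suc j′))) + core
        ≈⟨ +-congʳ (sumBelow-*ˡ n _ _) ⟩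
      q m * tailConvolution n + core  ∎

  convolution-step : ConvolutionHypothesis → ∀ m → R 1 * q m + tailConvolution m ≈ q̂ (suc m)
  convolution-step hyp m = trans (sym (sumBelow-head m _)) (hyp (suc m) (s≤s z≤n))

  doubleSum-step : ConvolutionHypothesis → ∀ m n →
    doubleSum m (suc n) + q m * q̂ (suc n) ≈ q̂ (suc m) * q n + doubleSum (suc m) n
  doubleSum-step hyp m n = begin
    doubleSum m (suc n) + q m * q̂ (suc n)
      ≈⟨ +-congˡ (*-congˡ (sym (convolution-step hyp n))) ⟩
    doubleSum m (suc n) + q m * (R 1 * q n + tailConvolution n)
      ≈⟨ solve 5 (λ T x r y Y → T :+ x :* (r :* y :+ Y) := (T :+ x :* Y) :+ r :* x :* y)
               refl _ _ _ _ _ ⟩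
    (doubleSum m (suc n) + q m * tailConvolution n) + R 1 * q m * q n
      ≈⟨ +-congʳ (doubleSum-exchange m n) ⟩
    (tailConvolution m * q n + doubleSum (suc m) n) + R 1 * q m * q n
      ≈⟨ solve 5 (λ X y T r x → (X :* y :+ T) :+ r :* x :* y := (r :* x :+ X) :* y :+ T)
               refl _ _ _ _ _ ⟩
    (R 1 * q m + tailConvolution m) * q n + doubleSum (suc m) n
      ≈⟨ +-congʳ (*-congʳ (convolution-step hyp m)) ⟩
    q̂ (suc m) * q n + doubleSum (suc m) n  ∎

  q̂₀≈0 : c 0 ≈ˢ 0ˢ → q̂ 0 ≈ 0#
  q̂₀≈0 c₀≈0 = begin
    ι (c 0) * q 0  ≈⟨ *-congʳ (trans (ι.⟦⟧-cong c₀≈0) ι.0#-homo) ⟩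
    0# * q 0       ≈⟨ zeroˡ (q 0) ⟩
    0#             ∎

  pairTerm-expand : ∀ i j → (c i -ˢ c j) · (q i * q j) ≈ q̂ i * q j - q i * q̂ j
  pairTerm-expand i j = begin
    ι (c i -ˢ c j) * (q i * q j)         ≈⟨ *-congʳ (trans (ι.+-homo _ _) (+-congˡ (ι.-‿homo _))) ⟩
    (ι (c i) - ι (c j)) * (q i * q j)    ≈⟨ distribʳ _ _ _ ⟩
    ι (c i) * (q i * q j) + - ι (c j) * (q i * q j)
      ≈⟨ +-cong (sym (*-assoc _ _ _))
                (trans (sym (-‿distribˡ-* _ _))
                       (-‿cong (solve 3 (λ b x y → b :* (x :* y) := x :* (b :* y)) refl _ _ _))) ⟩
    q̂ i * q j - q i * q̂ j                ∎

  pairSummand : ℕ → ℕ → ℕ → Carrier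
  pairSummand m n i =
    if ⌊ m <? i ⌋ ∧ ⌊ (m N.+ n ∸ i) ≤? i ⌋
    then (c i -ˢ c (m N.+ n ∸ i)) · (q i * q (m N.+ n ∸ i))
    else 0#

  pairSummand-low : ∀ m n i → i ≤ m → pairSummand m n i ≡ 0#
  pairSummand-low m n i i≤m with m <? i
  ... | yes m<i = contradiction m<i (NP.≤⇒≯ i≤m)
  ... | no  _   = P.refl

  antidiagonal-complement : ∀ {i j s} → i N.+ suc j ≡ s → s ∸ suc i ≡ j
  antidiagonal-complement {i} {j} P.refl =
    P.trans (P.cong (_∸ suc i) (NP.+-suc i j)) (NP.m+n∸m≡n (suc i) j)

  pairSummand-antidiagonal : ∀ m n i j → n ≤ m → m ≤ i → j < n → i N.+ suc j ≡ m N.+ n →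
    pairSummand m n (suc i) ≡ (c (suc i) -ˢ c j) · (q (suc i) * q j)
  pairSummand-antidiagonal m n i j n≤m m≤i j<n i+j≡m+n rewrite antidiagonal-complement i+j≡m+n
    with m <? suc i | j ≤? suc i
  ... | yes _   | yes _   = P.refl
  ... | no  m≮i | _       = contradiction (s≤s m≤i) m≮i
  ... | yes _   | no  j≰i =
    contradiction (NP.m≤n⇒m≤1+n (NP.≤-trans (NP.<⇒≤ j<n) (NP.≤-trans n≤m m≤i))) j≰i

  pairSum-antidiagonal : ∀ m n → n ≤ m →
    sumBelow (suc (m N.+ n)) (pairSummand m n)
      ≈ antidiagonal (λ i j → q̂ (suc i) * q j - q (suc i) * q̂ j) m n
  pairSum-antidiagonal m n n≤m = begin
    sumBelow (suc m N.+ n) (pairSummand m n)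
      ≈⟨ sumBelow-split (suc m) n _ ⟩
    sumBelow (suc m) (pairSummand m n) + sumBelow n (λ t → pairSummand m n (suc m N.+ t))
      ≈⟨ +-cong (sumBelow-vanishing (suc m) λ i i≤m → reflexive (pairSummand-low m n i (NP.≤-pred i≤m)))
                (sym (antidiagonal-sumBelow (λ i → pairSummand m n (suc i)) m n)) ⟩
    0# + antidiagonal (λ i _ → pairSummand m n (suc i)) m n
      ≈⟨ +-identityˡ _ ⟩
    antidiagonal (λ i _ → pairSummand m n (suc i)) m n
      ≈⟨ antidiagonal-cong m n (λ i j m≤i j<n i+j≡m+n →
           trans (reflexive (pairSummand-antidiagonal m n i j n≤m m≤i j<n i+j≡m+n))
                 (pairTerm-expand (suc i) j)) ⟩
    antidiagonal (λ i j → q̂ (suc i) * q j - q (suc i) * q̂ j) m n  ∎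

  -- Telescoping the recurrence along the antidiagonal and realigning the
  -- second sum with q̂ 0 = 0:
  --   T m n = Σ_{i+j=m+n, i>m} (q̂ i q j - q i q̂ j) - q m q̂ n.
  doubleSum-antidiagonal : ConvolutionHypothesis → c 0 ≈ˢ 0ˢ → ∀ m n →
    doubleSum m n ≈ antidiagonal (λ i j → q̂ (suc i) * q j - q (suc i) * q̂ j) m n - q m * q̂ n
  doubleSum-antidiagonal hyp c₀≈0 m n = begin
    doubleSum m n
      ≈⟨ sym (//-rightDividesʳ (antidiagonal qq̂ m n) (doubleSum m n)) ⟩
    (doubleSum m n + antidiagonal qq̂ m n) - antidiagonal qq̂ m n
      ≈⟨ +-cong (antidiagonal-telescope doubleSum q̂q qq̂ doubleSum-empty (doubleSum-step hyp) m n)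
                (-‿cong (antidiagonal-shift (λ i j → q i * q̂ j) qq̂₀≈0 m n)) ⟩
    antidiagonal q̂q m n - (q m * q̂ n + antidiagonal q′q̂ m n)
      ≈⟨ +-congˡ (sym (⁻¹-∙-comm _ _)) ⟩
    antidiagonal q̂q m n + (- (q m * q̂ n) - antidiagonal q′q̂ m n)
      ≈⟨ solve 3 (λ A u B → A :+ (u :+ B) := (A :+ B) :+ u) refl _ _ _ ⟩
    (antidiagonal q̂q m n - antidiagonal q′q̂ m n) - q m * q̂ n
      ≈⟨ +-congʳ (sym (antidiagonal-- q̂q q′q̂ m n)) ⟩
    antidiagonal (λ i j → q̂ (suc i) * q j - q (suc i) * q̂ j) m n - q m * q̂ n  ∎
    where
    q̂q qq̂ q′q̂ : ℕ → ℕ → Carrier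
    q̂q  i j = q̂ (suc i) * q j
    qq̂  i j = q i * q̂ (suc j)
    q′q̂ i j = q (suc i) * q̂ j

    qq̂₀≈0 : ∀ i → q i * q̂ 0 ≈ 0#
    qq̂₀≈0 i = trans (*-congˡ (q̂₀≈0 c₀≈0)) (zeroʳ (q i))

-- The theorem: for n ≤ m the double sum T m n equals the pair sum minus
-- c_n q_m q_n.
mainTheorem4 : ∀ {f ℓf a ℓa} (F : Field f ℓf) (𝒜 : CommAlgebra F a ℓa) →
    let open CommAlgebra 𝒜 in
    (R q : ℕ → Carrier) (c : ℕ → Scalar) →
    q 0 ≈ 1# →
    (∀ n → 1 ≤ n → sumBelow n (λ k → R (suc k) * q (n ∸ suc k)) ≈ c n · q n) →
    c 0 ≈ˢ 0ˢ →
    ∀ m n → 1 ≤ n → n ≤ m →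
    sumBelow m (λ i′ → sumBelow n (λ j′ →
    R (suc i′ N.+ suc j′) * q (m ∸ suc i′) * q (n ∸ suc j′)))
    ≈
    sumBelow (suc (m N.+ n)) (λ i →
    if ⌊ m <? i ⌋ ∧ ⌊ (m N.+ n ∸ i) ≤? i ⌋
    then (c i -ˢ c (m N.+ n ∸ i)) · (q i * q (m N.+ n ∸ i))
    else 0#)
    - c n · (q m * q n)
mainTheorem4 F 𝒜 R q c _ hyp c₀≈0 m n _ n≤m = begin
  doubleSum m n
    ≈⟨ doubleSum-antidiagonal hyp c₀≈0 m n ⟩
  antidiagonal (λ i j → q̂ (suc i) * q j - q (suc i) * q̂ j) m n - q m * (c n · q n)
    ≈⟨ +-cong (sym (pairSum-antidiagonal m n n≤m))
              (-‿cong (solve 3 (λ x γ y → x :* (γ :* y) := γ :* (x :* y)) refl _ _ _)) ⟩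
  sumBelow (suc (m N.+ n)) (pairSummand m n) - c n · (q m * q n)  ∎
  where
  open CommAlgebra 𝒜
  open SetoidReasoning setoid
  open SemiringSolver commutativeSemiring
  open AntiDiagonal 𝒜
  open Identity 𝒜 R q c
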